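{- In the type theory $\mathsf{CaTT}$, there is no term derivable in the empty context: there are no $t$, $A$ with $()\vdash t:A$.
   Context: $\mathsf{CaTT}$: raw terms are variables or expressions $\mathrm{coh}^{op}_{\Gamma,A}[\gamma]$ and $\mathrm{coh}_{\Gamma,A}[\gamma]$ ($\Gamma$ a context, $A$ a type, $\gamma$ a substitution); types are $\star$ or $t\to_Au$; contexts are lists $(x_i:A_i)$, substitutions lists $\langle x_i\mapsto t_i\rangle$. Term rules: $\Gamma\vdash$ and $(x:A)\in\Gamma$ give $\Gamma\vdash x:A$; (op): if $\Gamma\vdash_{ps}$, $\partial^-\Gamma\vdash t:A$, $\partial^+\Gamma\vdash u:A$, $\Delta\vdash\gamma:\Gamma$, $\mathrm{Var}(t:A)=\mathrm{Var}(\partial^-\Gamma)$, $\mathrm{Var}(u:A)=\mathrm{Var}(\partial^+\Gamma)$, then $\Delta\vdash\mathrm{coh}^{op}_{\Gamma,t\to_Au}[\gamma]:t[\gamma]\to_{A[\gamma]}u[\gamma]$; (coh): if $\Gamma\vdash_{ps}$, $\Gamma\vdash t:A$, $\Gamma\vdash u:A$, $\Delta\vdash\gamma:\Gamma$, $\mathrm{Var}(t:A)=\mathrm{Var}(u:A)=\mathrm{Var}\Gamma$, then $\Delta\vdash\mathrm{coh}_{\Gamma,t\to_Au}[\gamma]:t[\gamma]\to_{A[\gamma]}u[\gamma]$. Other rules: empty context valid, context extension by a fresh variable of a valid type, $\Gamma\vdash\star$, $\Gamma\vdash t\to_Au$ from $\Gamma\vdash A,\Gamma\vdash t:A,\Gamma\vdash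 u:A$, $\Delta\vdash\langle\rangle:()$, and $\Delta\vdash\langle\gamma,x\mapsto t\rangle:(\Gamma,x:A)$ from $\Delta\vdash\gamma:\Gamma$, $(\Gamma,x:A)\vdash$, $\Delta\vdash t:A[\gamma]$. Ps-contexts ($\Gamma\vdash_{ps}$) are derived from $(x:\star)\vdash_{ps}x:\star$ by the rules: $\Gamma\vdash_{ps}f:x\to_Ay$ gives $\Gamma\vdash_{ps}y:A$; $\Gamma\vdash_{ps}x:A$ gives $(\Gamma,y:A,f:x\to_Ay)\vdash_{ps}f:x\to_Ay$ for fresh $y,f$; $\Gamma\vdash_{ps}x:\star$ gives $\Gamma\vdash_{ps}$ (so ps-contexts are non-empty). $\partial^\pm\Gamma$ are the source/target ps-contexts of $\Gamma$ (remove the top-dimensional variables and the codimension-one variables that are targets, resp. sources, of top-dimensional ones; $\partial^\pm(x:\star)=(x:\star)$). $\mathrm{Var}$ denotes free variables, $\mathrm{Var}(\mathrm{coh}^{(op)}_{\Gamma,A}[\gamma])=\mathrm{Var}\gamma$, $\mathrm{Var}(t:A)=\mathrm{Var}t\cup\mathrm{Var}A$. -}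

module Defs where

open import Data.Nat using (ℕ; zero; suc; _⊔_; _≡ᵇ_; pred)
open import Data.Bool using (Bool; true; false; if_then_else_; _∨_; _∧_; not)
open import Data.List using (List; []; _∷_; _++_)
open import Data.List.Membership.Propositional using (_∈_)
open import Data.Product using (_×_; _,_)
open import Relation.Binary.PropositionalEquality using (_≡_)
open import Relation.Nullary using (¬_)

mutual
  data Tm : Set where
    var   : ℕ → Tm
    cohop : Ctx → Ty → Sub → Tm
    coh   : Ctx → Ty → Sub → Tm

  data Ty : Set where
    ⋆   : Ty
    arr : Tm → Ty → Tm → Ty

  data Ctx : Set where
    ∅     : Ctx
    _▸_∶_ : Ctx → ℕ → Ty → Ctx

  data Sub : Set where
    ⟨⟩     : Sub
    _▸_↦_ : Sub → ℕ → Tm → Sub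

infixl 5 _▸_∶_ _▸_↦_

lookupSub : Sub → ℕ → Tm
lookupSub ⟨⟩ x = var x
lookupSub (γ ▸ y ↦ t) x = if x ≡ᵇ y then t else lookupSub γ x

mutual
  _[_]t : Tm → Sub → Tm
  var x [ γ ]t = lookupSub γ x
  cohop Γ A δ [ γ ]t = cohop Γ A (δ ∘s γ)
  coh Γ A δ [ γ ]t = coh Γ A (δ ∘s γ)

  _∘s_ : Sub → Sub → Sub
  ⟨⟩ ∘s γ = ⟨⟩
  (δ ▸ x ↦ t) ∘s γ = (δ ∘s γ) ▸ x ↦ (t [ γ ]t)

_[_]T : Ty → Sub → Ty
⋆ [ γ ]T = ⋆
arr t A u [ γ ]T = arr (t [ γ ]t) (A [ γ ]T) (u [ γ ]t)

mutual
  VarTm : Tm → List ℕ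
  VarTm (var x) = x ∷ []
  VarTm (cohop Γ A γ) = VarSub γ
  VarTm (coh Γ A γ) = VarSub γ

  VarSub : Sub → List ℕ
  VarSub ⟨⟩ = []
  VarSub (γ ▸ x ↦ t) = VarSub γ ++ VarTm t

VarTy : Ty → List ℕ
VarTy ⋆ = []
VarTy (arr t A u) = VarTm t ++ VarTy A ++ VarTm u

VarTmTy : Tm → Ty → List ℕ
VarTmTy t A = VarTm t ++ VarTy A

VarCtx : Ctx → List ℕ
VarCtx ∅ = []
VarCtx (Γ ▸ x ∶ A) = VarCtx Γ ++ (x ∷ [])

_≈V_ : List ℕ → List ℕ → Set
V ≈V W = ∀ x → (x ∈ V → x ∈ W) × (x ∈ W → x ∈ V)

data _∶_∈Ctx_ : ℕ → Ty → Ctx → Set where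
  here  : ∀ {Γ x A} → x ∶ A ∈Ctx (Γ ▸ x ∶ A)
  there : ∀ {Γ x A y B} → x ∶ A ∈Ctx Γ → x ∶ A ∈Ctx (Γ ▸ y ∶ B)

dimTy : Ty → ℕ
dimTy ⋆ = 0
dimTy (arr _ A _) = suc (dimTy A)

dimCtx : Ctx → ℕ
dimCtx ∅ = 0
dimCtx (Γ ▸ _ ∶ A) = dimCtx Γ ⊔ dimTy A

isVar : Tm → ℕ → Bool
isVar (var y) x = y ≡ᵇ x
isVar (cohop _ _ _) x = false
isVar (coh _ _ _) x = false

-- Sign: true = source (∂⁻), false = target (∂⁺).
-- endpointOf s A x : the type A is an arrow whose source (s = true)
-- resp. target (s = false) is the variable x.
endpointOf : Bool → Ty → ℕ → Bool
endpointOf s ⋆ x = false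
endpointOf true  (arr t _ u) x = isVar u x   -- for ∂⁻, remove targets
endpointOf false (arr t _ u) x = isVar t x   -- for ∂⁺, remove sources

removedEnd : Bool → ℕ → Ctx → ℕ → Bool
removedEnd s n ∅ x = false
removedEnd s n (Δ ▸ _ ∶ A) x =
  ((dimTy A ≡ᵇ n) ∧ endpointOf s A x) ∨ removedEnd s n Δ x

filterBd : Bool → ℕ → Ctx → Ctx → Ctx
filterBd s n Γ ∅ = ∅
filterBd s n Γ (Δ ▸ x ∶ A) =
  if (dimTy A ≡ᵇ n) ∨ ((dimTy A ≡ᵇ pred n) ∧ removedEnd s n Γ x)
  then filterBd s n Γ Δ
  else (filterBd s n Γ Δ ▸ x ∶ A)

-- ∂ˢ Γ : remove the top-dimensional variables and the codimension-one
-- variables that are targets (s = true, ∂⁻) resp. sources (s = false, ∂⁺)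
-- of top-dimensional ones; in dimension 0 the context is unchanged.
∂ : Bool → Ctx → Ctx
∂ s Γ with dimCtx Γ
... | zero = Γ
... | suc n = filterBd s (suc n) Γ Γ

∂⁻ ∂⁺ : Ctx → Ctx
∂⁻ = ∂ true
∂⁺ = ∂ false

_∉Ctx_ : ℕ → Ctx → Set
x ∉Ctx Γ = ¬ (x ∈ VarCtx Γ)

data _⊢ps_∶_ : Ctx → ℕ → Ty → Set where
  pss : ∀ x → (∅ ▸ x ∶ ⋆) ⊢ps x ∶ ⋆
  psd : ∀ {Γ f x A y} → Γ ⊢ps f ∶ arr (var x) A (var y) → Γ ⊢ps y ∶ A
  pse : ∀ {Γ x A} y f → Γ ⊢ps x ∶ A →
        y ∉Ctx Γ → f ∉Ctx (Γ ▸ y ∶ A) →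
        (Γ ▸ y ∶ A ▸ f ∶ arr (var x) A (var y)) ⊢ps f ∶ arr (var x) A (var y)

data _⊢ps : Ctx → Set where
  ps : ∀ {Γ x} → Γ ⊢ps x ∶ ⋆ → Γ ⊢ps

mutual
  data _⊢ : Ctx → Set where
    ec : ∅ ⊢
    cc : ∀ {Γ x A} → Γ ⊢ → Γ ⊢T A → x ∉Ctx Γ → (Γ ▸ x ∶ A) ⊢

  data _⊢T_ : Ctx → Ty → Set where
    ⋆-rule  : ∀ {Γ} → Γ ⊢T ⋆
    arr-rule : ∀ {Γ t A u} → Γ ⊢T A → Γ ⊢ t ∶ A → Γ ⊢ u ∶ A → Γ ⊢T arr t A u

  data _⊢_∶_ : Ctx → Tm → Ty → Set where
    var-rule : ∀ {Γ x A} → Γ ⊢ → x ∶ A ∈Ctx Γ → Γ ⊢ var x ∶ A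
    op-rule  : ∀ {Γ Δ t A u γ} →
      Γ ⊢ps → ∂⁻ Γ ⊢ t ∶ A → ∂⁺ Γ ⊢ u ∶ A → Δ ⊢S γ ∶ Γ →
      VarTmTy t A ≈V VarCtx (∂⁻ Γ) → VarTmTy u A ≈V VarCtx (∂⁺ Γ) →
      Δ ⊢ cohop Γ (arr t A u) γ ∶ arr (t [ γ ]t) (A [ γ ]T) (u [ γ ]t)
    coh-rule : ∀ {Γ Δ t A u γ} →
      Γ ⊢ps → Γ ⊢ t ∶ A → Γ ⊢ u ∶ A → Δ ⊢S γ ∶ Γ →
      VarTmTy t A ≈V VarCtx Γ → VarTmTy u A ≈V VarCtx Γ →
      Δ ⊢ coh Γ (arr t A u) γ ∶ arr (t [ γ ]t) (A [ γ ]T) (u [ γ ]t)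

  data _⊢S_∶_ : Ctx → Sub → Ctx → Set where
    es : ∀ {Δ} → Δ ⊢S ⟨⟩ ∶ ∅
    cs : ∀ {Δ Γ γ x A t} → Δ ⊢S γ ∶ Γ → (Γ ▸ x ∶ A) ⊢ → Δ ⊢ t ∶ (A [ γ ]T) →
         Δ ⊢S (γ ▸ x ↦ t) ∶ (Γ ▸ x ∶ A)

-- A closed term cannot be a variable, so it is a coherence applied to a
-- substitution γ from the empty context into a ps-context. Ps-contexts are
-- non-empty, so γ supplies a closed term with a strictly smaller derivation;
-- induction on derivations rules out closed terms altogether.
module Submission where

open import Defs
open import Relation.Nullary using (¬_)
open import Relation.Binary.PropositionalEquality using (_≢_; refl)

⊢ps-nonempty : ∀ {Γ x A} → Γ ⊢ps x ∶ A → Γ ≢ ∅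
⊢ps-nonempty (pss x) ()
⊢ps-nonempty (psd Γ⊢ps) = ⊢ps-nonempty Γ⊢ps
⊢ps-nonempty (pse _ _ _ _ _) ()

mutual
  ∅-has-no-sub-into-ps : ∀ {Γ γ} → Γ ⊢ps → ¬ (∅ ⊢S γ ∶ Γ)
  ∅-has-no-sub-into-ps (ps Γ⊢ps) es = ⊢ps-nonempty Γ⊢ps refl
  ∅-has-no-sub-into-ps _ (cs _ _ ∅⊢t) = lemma4p10 _ _ ∅⊢t

  lemma4p10 : (t : Tm) (A : Ty) → ¬ (∅ ⊢ t ∶ A)
  lemma4p10 _ _ (var-rule _ ())
  lemma4p10 _ _ (op-rule Γps _ _ ∅⊢γ _ _) = ∅-has-no-sub-into-ps Γps ∅⊢γ
  lemma4p10 _ _ (coh-rule Γps _ _ ∅⊢γ _ _) = ∅-has-no-sub-into-ps Γps ∅⊢γ
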